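{- Let $\mathcal{S}=\langle\mathcal{L},\vdash\rangle$ be an LFI with respect to $\neg$ and $\bigcirc(p)$. Then: (i) pfECQ and sECQ hold in $\mathcal{S}$. (ii) If $\mathcal{S}$ is finitely gently explosive (i.e., $\bigcirc(p)$ is finite) and the signature of $\mathcal{S}$ contains a binary conjunction operator $\land$ such that $\{\alpha\land\beta\}\vdash\alpha$ and $\{\alpha\land\beta\}\vdash\beta$ for all $\alpha,\beta\in\mathcal{L}$, then spECQ and gECQ hold in $\mathcal{S}$.
   Context: $\mathcal{L}$ is the formula algebra over a denumerable set $V$ of variables in a finite signature containing a unary operator $\neg$; $C_\vdash(\Gamma)=\{\alpha:\Gamma\vdash\alpha\}$ for $\vdash\,\subseteq\mathcal{P}(\mathcal{L})\times\mathcal{L}$. $\mathcal{S}$ is standard if it is Tarskian (reflexive: $\Gamma\subseteq C_\vdash(\Gamma)$; monotonic: $\Gamma\subseteq\Sigma\Rightarrow C_\vdash(\Gamma)\subseteq C_\vdash(\Sigma)$; transitive: $\Sigma\subseteq C_\vdash(\Gamma)\Rightarrow C_\vdash(\Sigma)\subseteq C_\vdash(\Gamma)$), structural (closed under substitutions, i.e., endomorphisms of $\mathcal{L}$), and finitary ($\Gamma\vdash\alpha$ implies $\Gamma'\vdash\alpha$ for some finite $\Gamma'\subseteq\Gamma$). Let $p\in V$ and $\bigcirc(p)$ a nonempty set of formulas whose set of variables is exactly $\{p\}$; for $\varphi\in\mathcal{L}$, $\bigcirc(\varphi)=\{\psi(\varphi):\psi(p)\in\bigcirc(p)\}$ (substituting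 $\varphi$ for $p$). A standard logic $\mathcal{S}$ is an LFI with respect to $\neg$ and $\bigcirc(p)$ if: (a) there is $\varphi$ with $C_\vdash(\{\varphi,\neg\varphi\})\neq\mathcal{L}$; (b) there are $\alpha,\beta$ with $\beta\notin C_\vdash(\bigcirc(\alpha)\cup\{\alpha\})\cup C_\vdash(\bigcirc(\alpha)\cup\{\neg\alpha\})$; (c) $C_\vdash(\bigcirc(\varphi)\cup\{\varphi,\neg\varphi\})=\mathcal{L}$ for all $\varphi\in\mathcal{L}$. Principles: pfECQ: for every $\Gamma\subsetneq\mathcal{L}$ there is $\Delta\subsetneq\mathcal{L}$ with $\Gamma\subseteq\Delta$ and $C_\vdash(\Delta)=\mathcal{L}$. sECQ: for each $\alpha$ there is $\Gamma\subsetneq\mathcal{L}$ with $\alpha\in\Gamma$ and $C_\vdash(\Gamma)=\mathcal{L}$. spECQ: for every $\Gamma\subsetneq\mathcal{L}$ there is $\alpha$ with $\Gamma\cup\{\alpha\}\subsetneq\mathcal{L}$ and $C_\vdash(\Gamma\cup\{\alpha\})=\mathcal{L}$. gECQ: for each $\alpha$ there is $\beta$ with $C_\vdash(\{\alpha,\beta\})=\mathcal{L}$. -}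

module Defs where

open import Data.Nat using (ℕ)
open import Data.Fin using (Fin)
open import Data.Vec using (Vec; []; _∷_)
open import Data.List using (List)
open import Data.List.Membership.Propositional using (_∈_)
open import Data.List.Relation.Unary.All using (All)
open import Data.Product using (Σ; ∃; _×_; _,_)
open import Data.Sum using (_⊎_)
open import Data.Empty using (⊥)
open import Relation.Nullary using (¬_)
open import Relation.Binary.PropositionalEquality using (_≡_; subst; sym)
open import Relation.Nullary.Decidable using (⌊_⌋)
open import Data.Nat using (_≟_)
open import Data.Bool using (if_then_else_)
open import Function.Bundles using (_⇔_)

record Signature : Set where
  field
    nOps  : ℕ
    arity : Fin nOps → ℕ

module _ (Sg : Signature) where
  open Signature Sg

  data Form : Set where
    var : ℕ → Form
    op  : (o : Fin nOps) → Vec Form (arity o) → Form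

  -- Substitutions (endomorphisms of the formula algebra are determined by
  -- their values on variables).
  mutual
    sub : (ℕ → Form) → Form → Form
    sub σ (var v)   = σ v
    sub σ (op o as) = op o (subV σ as)

    subV : ∀ {k} → (ℕ → Form) → Vec Form k → Vec Form k
    subV σ []       = []
    subV σ (a ∷ as) = sub σ a ∷ subV σ as

  mutual
    Occ : ℕ → Form → Set
    Occ v (var w)   = v ≡ w
    Occ v (op o as) = OccV v as

    OccV : ∀ {k} → ℕ → Vec Form k → Set
    OccV v []       = ⊥
    OccV v (a ∷ as) = Occ v a ⊎ OccV v as

  un : (o : Fin nOps) → arity o ≡ 1 → Form → Form
  un o e φ = op o (subst (Vec Form) (sym e) (φ ∷ []))

  bin : (o : Fin nOps) → arity o ≡ 2 → Form → Form → Form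
  bin o e φ ψ = op o (subst (Vec Form) (sym e) (φ ∷ ψ ∷ []))

  FSet : Set₁
  FSet = Form → Set

  Conseq : Set₁
  Conseq = FSet → Form → Set

  _⊆_ : FSet → FSet → Set
  Γ ⊆ Δ = ∀ α → Γ α → Δ α

  _∪_ : FSet → FSet → FSet
  (Γ ∪ Δ) α = Γ α ⊎ Δ α

  single : Form → FSet
  single φ α = α ≡ φ

  pair : Form → Form → FSet
  pair φ ψ α = (α ≡ φ) ⊎ (α ≡ ψ)

  Proper : FSet → Set
  Proper Γ = ∃ λ α → ¬ Γ α

  Trivial : Conseq → FSet → Set
  Trivial _⊢_ Γ = ∀ α → Γ ⊢ α

  image : (ℕ → Form) → FSet → FSet
  image σ Γ β = ∃ λ γ → Γ γ × (β ≡ sub σ γ)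

  Reflexive : Conseq → Set₁
  Reflexive _⊢_ = ∀ Γ α → Γ α → Γ ⊢ α

  Monotonic : Conseq → Set₁
  Monotonic _⊢_ = ∀ Γ Δ → Γ ⊆ Δ → ∀ α → Γ ⊢ α → Δ ⊢ α

  Transitive : Conseq → Set₁
  Transitive _⊢_ = ∀ Γ Δ → (∀ β → Δ β → Γ ⊢ β) → ∀ α → Δ ⊢ α → Γ ⊢ α

  Tarskian : Conseq → Set₁
  Tarskian ⊢ = Reflexive ⊢ × Monotonic ⊢ × Transitive ⊢

  Structural : Conseq → Set₁
  Structural _⊢_ = ∀ (σ : ℕ → Form) Γ α → Γ ⊢ α → image σ Γ ⊢ sub σ α

  Finitary : Conseq → Set₁
  Finitary _⊢_ = ∀ Γ α → Γ ⊢ α →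
    Σ (List Form) λ Δ → All Γ Δ × ((λ β → β ∈ Δ) ⊢ α)

  Standard : Conseq → Set₁
  Standard ⊢ = Tarskian ⊢ × Structural ⊢ × Finitary ⊢

  IsCirc : ℕ → FSet → Set
  IsCirc p Circ = (∃ λ ψ → Circ ψ) × (∀ ψ → Circ ψ → ∀ v → (Occ v ψ ⇔ (v ≡ p)))

  [_↦_] : ℕ → Form → ℕ → Form
  [ p ↦ φ ] v = if ⌊ v ≟ p ⌋ then φ else var v

  circ : ℕ → FSet → Form → FSet
  circ p Circ φ χ = ∃ λ ψ → Circ ψ × (χ ≡ sub [ p ↦ φ ] ψ)

  IsLFI : Conseq → (neg : Fin nOps) → arity neg ≡ 1 → ℕ → FSet → Set₁
  IsLFI _⊢_ neg e p Circ =
    Standard _⊢_ × IsCirc p Circ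
    × (∃ λ φ → ¬ Trivial _⊢_ (pair φ (un neg e φ)))
    × (∃ λ α → ∃ λ β →
         ¬ ((circ p Circ α ∪ single α) ⊢ β) × ¬ ((circ p Circ α ∪ single (un neg e α)) ⊢ β))
    × (∀ φ → Trivial _⊢_ (circ p Circ φ ∪ (pair φ (un neg e φ))))

  pfECQ : Conseq → Set₁
  pfECQ ⊢ = ∀ Γ → Proper Γ → Σ FSet λ Δ → Proper Δ × Γ ⊆ Δ × Trivial ⊢ Δ

  sECQ : Conseq → Set₁
  sECQ ⊢ = ∀ α → Σ FSet λ Γ → Proper Γ × Γ α × Trivial ⊢ Γ

  spECQ : Conseq → Set₁
  spECQ ⊢ = ∀ Γ → Proper Γ → ∃ λ α → Proper (Γ ∪ single α) × Trivial ⊢ (Γ ∪ single α)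

  gECQ : Conseq → Set
  gECQ ⊢ = ∀ α → ∃ λ β → Trivial ⊢ (pair α β)

  FiniteSet : FSet → Set
  FiniteSet Γ = ∃ λ (l : List Form) → ∀ ψ → (Γ ψ ⇔ (ψ ∈ l))

{-# OPTIONS --safe #-}
-- Every ψ(p) ∈ ○(p) contains p, so each member of ○(¬γ) ∪ {¬γ, ¬¬γ} is
-- strictly larger than γ. This explosive set therefore lies inside L ∖ {γ},
-- which is thus trivial by monotonicity; pfECQ and sECQ follow at once. When ○(p) is finite, the conjunction of γ, ¬γ and the
-- members of ○(γ) entails each of them, so on its own it is an explosive formula
-- distinct from γ; adding it to any set gives spECQ and gECQ.
module Submission where

open import Defs
open import Data.Nat using (ℕ; suc; _+_; _≤_; _<_; s≤s; _≟_)
open import Data.Nat.Properties using (≤-refl; ≤-trans; m≤m+n; m≤n+m; m≤n⇒m≤1+n; <-irrefl; <-≤-trans; <-trans)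
open import Data.Fin using (Fin)
open import Data.Vec using (Vec; []; _∷_)
open import Data.List using (List; []; _∷_; map)
open import Data.List.Membership.Propositional using (_∈_)
open import Data.List.Membership.Propositional.Properties using (∈-map⁺)
open import Data.List.Relation.Unary.Any using (here; there)
open import Data.Product using (_×_; _,_; ∃)
open import Data.Sum using (inj₁; inj₂)
open import Relation.Nullary using (¬_; yes; no; contradiction)
open import Relation.Binary.PropositionalEquality using (_≡_; _≢_; refl; sym; subst)
open import Function.Bundles using (Equivalence)

module _ {Sg : Signature} where
  open Signature Sg

  mutual
    size : Form Sg → ℕ
    size (var _)   = 1
    size (op o as) = suc (sizeV as)

    sizeV : ∀ {k} → Vec (Form Sg) k → ℕ
    sizeV []       = 0
    sizeV (a ∷ as) = size a + sizeV as

  sizeV-subst : ∀ {k l} (e : k ≡ l) (as : Vec (Form Sg) l) →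
                sizeV (subst (Vec (Form Sg)) (sym e) as) ≡ sizeV as
  sizeV-subst refl as = refl

  size-un : ∀ o e φ → size φ < size (un Sg o e φ)
  size-un o e φ rewrite sizeV-subst e (φ ∷ []) = s≤s (m≤m+n _ _)

  size-binˡ : ∀ o e φ ψ → size φ < size (bin Sg o e φ ψ)
  size-binˡ o e φ ψ rewrite sizeV-subst e (φ ∷ ψ ∷ []) = s≤s (m≤m+n _ _)

  size<⇒≢ : ∀ {φ ψ} → size φ < size ψ → ψ ≢ φ
  size<⇒≢ φ<φ refl = <-irrefl refl φ<φ

  mutual
    Occ⇒size≤sub : ∀ σ v ψ → Occ Sg v ψ → size (σ v) ≤ size (sub Sg σ ψ)
    Occ⇒size≤sub σ v (var w)   refl = ≤-refl
    Occ⇒size≤sub σ v (op o as) v∈as = m≤n⇒m≤1+n (OccV⇒size≤subV σ v as v∈as)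

    OccV⇒size≤subV : ∀ {k} σ v (as : Vec (Form Sg) k) → OccV Sg v as →
                     size (σ v) ≤ sizeV (subV Sg σ as)
    OccV⇒size≤subV σ v (a ∷ as) (inj₁ v∈a)  = ≤-trans (Occ⇒size≤sub σ v a v∈a) (m≤m+n _ _)
    OccV⇒size≤subV σ v (a ∷ as) (inj₂ v∈as) = ≤-trans (OccV⇒size≤subV σ v as v∈as) (m≤n+m _ _)

  ↦-self : ∀ p φ → [_↦_] Sg p φ p ≡ φ
  ↦-self p φ with p ≟ p
  ... | yes _   = refl
  ... | no p≢p = contradiction refl p≢p

  circ-size : ∀ {p Circ φ χ} → IsCirc Sg p Circ → circ Sg p Circ φ χ → size φ ≤ size χ
  circ-size {p} {φ = φ} (_ , vars) (ψ , ψ∈Circ , refl) =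
    subst (λ ξ → size ξ ≤ size (sub Sg ([_↦_] Sg p φ) ψ)) (↦-self p φ)
      (Occ⇒size≤sub ([_↦_] Sg p φ) p ψ (Equivalence.from (vars ψ ψ∈Circ p) refl))

  ○-contradiction : (neg : Fin nOps) → arity neg ≡ 1 → ℕ → FSet Sg → Form Sg → FSet Sg
  ○-contradiction neg e p Circ φ = _∪_ Sg (circ Sg p Circ φ) (pair Sg φ (un Sg neg e φ))

  AllBut : Form Sg → FSet Sg
  AllBut γ β = β ≢ γ

  AllBut-proper : ∀ γ → Proper Sg (AllBut γ)
  AllBut-proper γ = γ , λ γ≢γ → γ≢γ refl

  ○-contradiction-¬⊆AllBut : ∀ {neg e p Circ} → IsCirc Sg p Circ → ∀ γ →
    _⊆_ Sg (○-contradiction neg e p Circ (un Sg neg e γ)) (AllBut γ)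
  ○-contradiction-¬⊆AllBut {neg} {e} isc γ β (inj₁ β∈○¬γ) =
    size<⇒≢ (<-≤-trans (size-un neg e γ) (circ-size isc β∈○¬γ))
  ○-contradiction-¬⊆AllBut {neg} {e} _ γ β (inj₂ (inj₁ refl)) = size<⇒≢ (size-un neg e γ)
  ○-contradiction-¬⊆AllBut {neg} {e} _ γ β (inj₂ (inj₂ refl)) =
    size<⇒≢ (<-trans (size-un neg e γ) (size-un neg e (un Sg neg e γ)))

  ⋀ : (and : Fin nOps) → arity and ≡ 2 → Form Sg → List (Form Sg) → Form Sg
  ⋀ and e₂ φ []       = φ
  ⋀ and e₂ φ (ψ ∷ ψs) = bin Sg and e₂ φ (⋀ and e₂ ψ ψs)

module _ {Sg : Signature} (_⊢_ : Conseq Sg) where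
  open Signature Sg

  trivial-⊆ : Monotonic Sg _⊢_ → ∀ {Γ Δ} → _⊆_ Sg Γ Δ → Trivial Sg _⊢_ Γ → Trivial Sg _⊢_ Δ
  trivial-⊆ mono Γ⊆Δ Γ-trivial α = mono _ _ Γ⊆Δ α (Γ-trivial α)

  trivial-⊢ : Transitive Sg _⊢_ → ∀ {Γ Δ} → (∀ β → Δ β → Γ ⊢ β) →
              Trivial Sg _⊢_ Δ → Trivial Sg _⊢_ Γ
  trivial-⊢ trans Γ⊢Δ Δ-trivial α = trans _ _ Γ⊢Δ α (Δ-trivial α)

  module _ (refl⊢ : Reflexive Sg _⊢_) (trans : Transitive Sg _⊢_)
           (and : Fin nOps) (e₂ : arity and ≡ 2)
           (∧-elimˡ : ∀ α β → single Sg (bin Sg and e₂ α β) ⊢ α)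
           (∧-elimʳ : ∀ α β → single Sg (bin Sg and e₂ α β) ⊢ β) where

    ⋀-elim : ∀ φ ψs χ → χ ∈ φ ∷ ψs → single Sg (⋀ and e₂ φ ψs) ⊢ χ
    ⋀-elim φ []       χ (here χ≡φ) = refl⊢ _ χ χ≡φ
    ⋀-elim φ (ψ ∷ ψs) χ (here refl) = ∧-elimˡ φ (⋀ and e₂ ψ ψs)
    ⋀-elim φ (ψ ∷ ψs) χ (there χ∈ψs) =
      trans _ (single Sg (⋀ and e₂ ψ ψs))
        (λ { β refl → ∧-elimʳ φ (⋀ and e₂ ψ ψs) }) χ
        (⋀-elim ψ ψs χ χ∈ψs)

    ⋀-○-contradiction-trivial : ∀ {neg e p Circ} (cs : List (Form Sg)) →
      (∀ ψ → Circ ψ → ψ ∈ cs) →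
      (∀ φ → Trivial Sg _⊢_ (○-contradiction neg e p Circ φ)) → ∀ φ →
      Trivial Sg _⊢_ (single Sg (⋀ and e₂ φ (un Sg neg e φ ∷ map (sub Sg ([_↦_] Sg p φ)) cs)))
    ⋀-○-contradiction-trivial {neg} {e} {p} {Circ} cs Circ⊆cs expl φ =
      trivial-⊢ trans entails (expl φ)
      where
      entails : ∀ β → ○-contradiction neg e p Circ φ β →
                single Sg (⋀ and e₂ φ (un Sg neg e φ ∷ map (sub Sg ([_↦_] Sg p φ)) cs)) ⊢ β
      entails β (inj₁ (ψ , ψ∈Circ , refl)) =
        ⋀-elim φ (un Sg neg e φ ∷ _) β (there (there (∈-map⁺ (sub Sg ([_↦_] Sg p φ)) (Circ⊆cs ψ ψ∈Circ))))
      entails β (inj₂ (inj₁ refl)) = ⋀-elim φ (un Sg neg e φ ∷ _) β (here refl)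
      entails β (inj₂ (inj₂ refl)) = ⋀-elim φ (un Sg neg e φ ∷ _) β (there (here refl))

  pfECQ-from-AllBut : (∀ γ → Trivial Sg _⊢_ (AllBut γ)) → pfECQ Sg _⊢_
  pfECQ-from-AllBut AllBut-trivial Γ (γ , γ∉Γ) =
    AllBut γ , AllBut-proper γ , (λ { β β∈Γ refl → γ∉Γ β∈Γ }) , AllBut-trivial γ

  sECQ-from-AllBut : (neg : Fin nOps) (e : arity neg ≡ 1) →
                     (∀ γ → Trivial Sg _⊢_ (AllBut γ)) → sECQ Sg _⊢_
  sECQ-from-AllBut neg e AllBut-trivial α =
    AllBut (un Sg neg e α) , AllBut-proper _ , (λ α≡¬α → size<⇒≢ (size-un neg e α) (sym α≡¬α)) ,
    AllBut-trivial (un Sg neg e α)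

  spECQ-from-explosive : Monotonic Sg _⊢_ →
    (∀ γ → ∃ λ φ → φ ≢ γ × Trivial Sg _⊢_ (single Sg φ)) → spECQ Sg _⊢_
  spECQ-from-explosive mono explosive Γ (γ , γ∉Γ) with explosive γ
  ... | φ , φ≢γ , φ-trivial = φ , (γ , γ∉Γ∪φ) , trivial-⊆ mono (λ _ → inj₂) φ-trivial
    where
    γ∉Γ∪φ : ¬ (_∪_ Sg Γ (single Sg φ)) γ
    γ∉Γ∪φ (inj₁ γ∈Γ) = γ∉Γ γ∈Γ
    γ∉Γ∪φ (inj₂ γ≡φ) = φ≢γ (sym γ≡φ)

  gECQ-from-explosive : Monotonic Sg _⊢_ →
    (∀ γ → ∃ λ φ → Trivial Sg _⊢_ (single Sg φ)) → gECQ Sg _⊢_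
  gECQ-from-explosive mono explosive α with explosive α
  ... | φ , φ-trivial = φ , trivial-⊆ mono (λ _ → inj₂) φ-trivial

theorem3p37 : (Sg : Signature) (_⊢_ : Conseq Sg)
    (neg : Fin (Signature.nOps Sg)) (e : Signature.arity Sg neg ≡ 1)
    (p : ℕ) (Circ : FSet Sg) →
    IsLFI Sg _⊢_ neg e p Circ →
    (pfECQ Sg _⊢_ × sECQ Sg _⊢_)
    × (FiniteSet Sg Circ →
       (and : Fin (Signature.nOps Sg)) (e₂ : Signature.arity Sg and ≡ 2) →
       (∀ α β → single Sg (bin Sg and e₂ α β) ⊢ α) →
       (∀ α β → single Sg (bin Sg and e₂ α β) ⊢ β) →
       spECQ Sg _⊢_ × gECQ Sg _⊢_)
theorem3p37 Sg _⊢_ neg e p Circ (((refl⊢ , mono , trans) , _) , isc , _ , _ , expl) =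
  (pfECQ-from-AllBut _⊢_ AllBut-trivial , sECQ-from-AllBut _⊢_ neg e AllBut-trivial) ,
  λ (cs , Circ⇔cs) and e₂ ∧-elimˡ ∧-elimʳ →
    let conjunction-trivial = ⋀-○-contradiction-trivial _⊢_ refl⊢ trans and e₂ ∧-elimˡ ∧-elimʳ
                                cs (λ ψ → Equivalence.to (Circ⇔cs ψ)) expl
    in spECQ-from-explosive _⊢_ mono (λ γ → _ , size<⇒≢ (size-binˡ and e₂ γ _) , conjunction-trivial γ) ,
       gECQ-from-explosive _⊢_ mono (λ γ → _ , conjunction-trivial γ)
  where
  AllBut-trivial : ∀ γ → Trivial Sg _⊢_ (AllBut γ)
  AllBut-trivial γ = trivial-⊆ _⊢_ mono (○-contradiction-¬⊆AllBut isc γ) (expl (un Sg neg e γ))
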